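{- Let $a\ge2$, $\ell\ge1$, $n=a+\ell-1$, $\mu=(a,1^{\ell-1})$, $\rho=(a-1,1^\ell)$. Then $\dim_{\mathbb{Q}}(\mathcal{H}_\mu\cap\mathcal{H}_\rho)\ge \frac{n!}{2}$.
   Context: Let $\mathbb{Q}[X,Y]=\mathbb{Q}[x_1,\dots,x_n;y_1,\dots,y_n]$. For $\nu\vdash n$ with cells at coordinates $(p_1,q_1),\dots,(p_n,q_n)$ (row $p$, column $q$, indexed from $1$, French convention: row $1$ is the bottom row), let $\Delta_\nu=\det(x_i^{p_j-1}y_i^{q_j-1})_{i,j=1}^n$, $I_\nu=\{f: f(\partial/\partial X;\partial/\partial Y)\Delta_\nu=0\}$, and $\mathcal{H}_\nu=\mathbb{Q}[X,Y]/I_\nu$ (the Garsia–Haiman module). For a hook $\nu\vdash n$, a standard filling $S$ is a bijection from the cells of $\nu$ to $\{1,\dots,n\}$. A row inversion is a pair $(t,r)$ of entries of row $1$ with $t$ left of $r$ and $t>r$; a column inversion is a pair $(d,c)$ of entries of column $1$ with $d$ above $c$ and $d>c$. Let $\varphi_S=\prod_{(d,c)\text{ col. inv.}}x_d\prod_{(t,r)\text{ row inv.}}y_r$. It is known (Adin–Remmel–Roichman) that $\{\varphi_S\}$ over standard fillings of $\nu$ gives a basis of $\mathcal{H}_\nu$. Convention used by the paper for the intersection: each $\mathcal{H}_\nu$ ($\nu$ a hook) is regarded as the subspace of $\mathbb{Q}[X,Y]$ spanned by $\{\varphi_S: S\text{ a standard filling of }\nu\}$, and the intersection is taken in $\mathbb{Q}[X,Y]$.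 -}

module Defs where

open import Data.Nat using (ℕ; zero; suc; _+_; _*_; _∸_; _≤_; _<_; _≤?_; _<?_)
import Data.Nat as ℕ
open import Data.Fin using (Fin; toℕ)
open import Data.Vec using (Vec; tabulate)
import Data.Vec.Properties as VecP
open import Data.List using (List; []; _∷_; map; concatMap; foldr; filter; length; _++_)
open import Data.List.Base using (allFin)
open import Data.Product using (Σ; ∃; _×_; _,_; proj₁; proj₂)
import Data.Product.Properties as ProdP
open import Data.Sum using (_⊎_)
open import Data.Rational using (ℚ; 0ℚ) renaming (_+_ to _+ℚ_; _*_ to _*ℚ_)
open import Relation.Binary.PropositionalEquality using (_≡_)
open import Relation.Nullary using (Dec; yes; no; _×-dec_)

-- A monomial x^α y^β is given by its two exponent vectors (α , β).
-- Variable x_i (i = 1..n) corresponds to index (i-1) : Fin n.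
Mono : ℕ → Set
Mono n = Vec ℕ n × Vec ℕ n

mono-≟ : ∀ {n} (m m' : Mono n) → Dec (m ≡ m')
mono-≟ = ProdP.≡-dec (VecP.≡-dec ℕ._≟_) (VecP.≡-dec ℕ._≟_)

Poly : ℕ → Set
Poly n = List (ℚ × Mono n)

coeff : ∀ {n} → Poly n → Mono n → ℚ
coeff [] m = 0ℚ
coeff ((c , m') ∷ p) m with mono-≟ m' m
... | yes _ = c +ℚ coeff p m
... | no  _ = coeff p m

_≈P_ : ∀ {n} → Poly n → Poly n → Set
p ≈P q = ∀ m → coeff p m ≡ coeff q m

zeroP : ∀ {n} → Poly n
zeroP = []

monoP : ∀ {n} → Mono n → Poly n
monoP m = (Data.Rational.1ℚ , m) ∷ []

scale : ∀ {n} → ℚ → Poly n → Poly n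
scale c = map (λ t → c *ℚ proj₁ t , proj₂ t)

linComb : ∀ {n} → List (ℚ × Poly n) → Poly n
linComb = foldr (λ t acc → scale (proj₁ t) (proj₂ t) ++ acc) []

linCombFin : ∀ {n k} → (Fin k → ℚ) → (Fin k → Poly n) → Poly n
linCombFin {k = k} λ' f = linComb (map (λ i → λ' i , f i) (allFin k))

LinIndep : ∀ {n k} → (Fin k → Poly n) → Set
LinIndep {k = k} f = ∀ (λ' : Fin k → ℚ) → linCombFin λ' f ≈P zeroP → ∀ i → λ' i ≡ 0ℚ

-- The hook with bottom row of length r and first column of height h
-- (French convention; cell (p , q) = row p, column q, 1-indexed).
-- μ = (a, 1^(ℓ-1)) is Hook a ℓ ;  ρ = (a-1, 1^ℓ) is Hook (a-1) (ℓ+1).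
InHook : ℕ → ℕ → ℕ × ℕ → Set
InHook r h (p , q) = (p ≡ 1 × 1 ≤ q × q ≤ r) ⊎ (q ≡ 1 × 1 ≤ p × p ≤ h)

-- A standard filling of the hook (r,h) with entries 1..n (entry i+1 is
-- represented by i : Fin n), given by the position of each entry; the map
-- entry ↦ position is a bijection onto the cells of the hook.
record Filling (n r h : ℕ) : Set where
  field
    pos     : Fin n → ℕ × ℕ
    inHook  : ∀ i → InHook r h (pos i)
    inj     : ∀ i j → pos i ≡ pos j → i ≡ j
    surj    : ∀ c → InHook r h c → ∃ λ i → pos i ≡ c
open Filling public

countFin : ∀ {n} {P : Fin n → Set} → (∀ j → Dec (P j)) → ℕ
countFin {n} dec = length (filter dec (allFin n))

-- exponent of x_d in φ_S : number of column inversions (d , c), i.e. entries c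
-- in column 1 strictly below d (d also in column 1) with d > c.
xExp : ∀ {n r h} → Filling n r h → Fin n → ℕ
xExp S d = countFin (λ c →
  (proj₂ (pos S d) ℕ.≟ 1) ×-dec ((proj₂ (pos S c) ℕ.≟ 1) ×-dec
  ((proj₁ (pos S c) <? proj₁ (pos S d)) ×-dec (toℕ c <? toℕ d))))

-- exponent of y_r in φ_S : number of row inversions (t , r), i.e. entries t
-- in row 1 strictly left of r (r also in row 1) with t > r.
yExp : ∀ {n r h} → Filling n r h → Fin n → ℕ
yExp S r' = countFin (λ t →
  (proj₁ (pos S r') ℕ.≟ 1) ×-dec ((proj₁ (pos S t) ℕ.≟ 1) ×-dec
  ((proj₂ (pos S t) <? proj₂ (pos S r')) ×-dec (toℕ r' <? toℕ t))))

φ : ∀ {n r h} → Filling n r h → Poly n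
φ S = monoP (tabulate (xExp S) , tabulate (yExp S))

InH : (n r h : ℕ) → Poly n → Set
InH n r h f = Σ (List (ℚ × Filling n r h)) λ L →
  f ≈P linComb (map (λ t → proj₁ t , φ (proj₂ t)) L)

{-# OPTIONS --safe #-}

-- Fix entries c < c′ of {1..n} and split the remaining n - 2 entries into a word A of length ℓ - 1
-- and a word D of length a - 1; there are n!/2 such choices.  Let X be the Lehmer code of the word
-- A c (number of later, smaller letters) and Y the code of D c′ for the reversed order.  Then x^X y^Y
-- is φ_S for the filling of μ with corner c, column A and a row rearranged from c′ D, and also for
-- the filling of ρ with corner c′, row D and a column rearranged from c A: a code bounded by the
-- number of smaller letters is realised by a unique arrangement, and the extra corner only adds a
-- term the rearrangement can absorb.  Distinct choices give distinct monomials: the entries with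
-- X ≠ 0, together with the common zeros of X and Y up to a threshold t, form a set whose size grows
-- with t and equals ℓ exactly at t = c; c′ is the least common zero above c; and A, D are recovered
-- from their codes.  Distinct monomials are linearly independent, whence dim ≥ n!/2.
module Submission where

open import Defs
open import Data.Bool using (Bool; true; false; _∧_; if_then_else_; T?)
open import Data.Bool.Properties using (T-≡; ∧-zeroʳ)
open import Data.Empty using (⊥; ⊥-elim)
open import Data.Fin as Fin using (Fin; toℕ; zero; suc; remQuot; combine)
import Data.Fin.Properties as Finₚ
open import Data.List using (List; []; _∷_; _++_; [_]; _∷ʳ_; length; map; filter; allFin; take; drop; reverse)
import Data.List.Properties as Listₚ
open import Data.List.Membership.Propositional using (_∈_; _∉_)
open import Data.List.Membership.Propositional.Properties
  using (∈-allFin; ∈-++⁺ˡ; ∈-++⁺ʳ; ∈-++⁻; ∈-∃++; ∈-map⁺; ∈-map⁻; ∈-filter⁺; ∈-filter⁻)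
import Data.List.Membership.DecPropositional as DecMembership
open import Data.List.Membership.Propositional.Properties.WithK using (unique∧set⇒bag)
open import Data.List.Relation.Binary.BagAndSetEquality using (∼bag⇒↭)
open import Data.List.Relation.Binary.Permutation.Propositional as ↭
  using (_↭_; ↭-sym; ↭-refl; ↭-trans; ↭⇒↭ₛ; prep; swap)
import Data.List.Relation.Binary.Permutation.Propositional.Properties as ↭ₚ
import Data.List.Relation.Binary.Permutation.Setoid.Properties as ↭ₛₚ
open import Data.List.Relation.Unary.Any using (here; there)
open import Data.List.Relation.Unary.All as All using (All; []; _∷_)
import Data.List.Relation.Unary.All.Properties as Allₚ
open import Data.List.Relation.Unary.AllPairs as AllPairs using (AllPairs; []; _∷_)
import Data.List.Relation.Unary.AllPairs.Properties as AllPairsₚ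
open import Data.List.Relation.Unary.Unique.Propositional using (Unique)
import Data.List.Relation.Unary.Unique.Propositional.Properties as Uniqueₚ
open import Data.Nat as ℕ using (ℕ; zero; suc; _+_; _*_; _∸_; _≤_; _<_; z≤n; s≤s; _<?_; _≤?_; _!)
import Data.Nat.Properties as ℕₚ
import Algebra.Properties.CommutativeSemigroup as CommutativeSemigroupProperties
open CommutativeSemigroupProperties ℕₚ.+-commutativeSemigroup using () renaming (x∙yz≈y∙xz to m+[n+o]≡n+[m+o])
open CommutativeSemigroupProperties ℕₚ.*-commutativeSemigroup using () renaming (x∙yz≈y∙xz to m*[n*o]≡n*[m*o])
open import Data.Product as Product using (Σ; ∃; _×_; _,_; proj₁; proj₂; map₂)
open import Data.Rational using (ℚ; 0ℚ; 1ℚ)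
import Data.Rational.Properties as ℚₚ
open import Data.Sum as Sum using (_⊎_; inj₁; inj₂)
open import Data.Vec as Vec using (Vec; []; _∷_; tabulate; toList; lookup)
import Data.Vec.Properties as Vecₚ
open import Function using (_∘_; flip; id)
open import Function.Bundles using (mk⇔; Equivalence)
open import Relation.Binary.Definitions using (DecidableEquality; tri<; tri≈; tri>)
open import Relation.Binary.PropositionalEquality
  using (_≡_; _≢_; refl; sym; trans; cong; cong₂; subst; subst₂; setoid; module ≡-Reasoning)
open import Relation.Nullary using (Dec; yes; no; does; ¬_)
open import Relation.Nullary.Decidable using (dec-true; dec-false)

indicator : Bool → ℕ
indicator true  = 1
indicator false = 0

countᵇ : {A : Set} → (A → Bool) → List A → ℕ
countᵇ p []       = 0
countᵇ p (x ∷ xs) = indicator (p x) + countᵇ p xs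

module _ {A : Set} where

  countᵇ-++ : ∀ (p : A → Bool) xs ys → countᵇ p (xs ++ ys) ≡ countᵇ p xs + countᵇ p ys
  countᵇ-++ p []       ys = refl
  countᵇ-++ p (x ∷ xs) ys =
    trans (cong (indicator (p x) +_) (countᵇ-++ p xs ys)) (sym (ℕₚ.+-assoc (indicator (p x)) _ _))

  countᵇ-↭ : ∀ (p : A → Bool) {xs ys} → xs ↭ ys → countᵇ p xs ≡ countᵇ p ys
  countᵇ-↭ p ↭.refl = refl
  countᵇ-↭ p (prep x q) = cong (indicator (p x) +_) (countᵇ-↭ p q)
  countᵇ-↭ p (swap x y q) =
    trans (cong (λ k → indicator (p x) + (indicator (p y) + k)) (countᵇ-↭ p q))
          (m+[n+o]≡n+[m+o] (indicator (p x)) (indicator (p y)) _)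
  countᵇ-↭ p (↭.trans q r) = trans (countᵇ-↭ p q) (countᵇ-↭ p r)

  countᵇ-map : ∀ {B : Set} (p : B → Bool) (f : A → B) xs → countᵇ p (map f xs) ≡ countᵇ (p ∘ f) xs
  countᵇ-map p f []       = refl
  countᵇ-map p f (x ∷ xs) = cong (indicator (p (f x)) +_) (countᵇ-map p f xs)

  countᵇ-cong : ∀ (p q : A → Bool) xs → (∀ {x} → x ∈ xs → p x ≡ q x) → countᵇ p xs ≡ countᵇ q xs
  countᵇ-cong p q []       p≗q = refl
  countᵇ-cong p q (x ∷ xs) p≗q =
    cong₂ _+_ (cong indicator (p≗q (here refl))) (countᵇ-cong p q xs (p≗q ∘ there))

  countᵇ-none : ∀ (p : A → Bool) xs → (∀ {x} → x ∈ xs → p x ≡ false) → countᵇ p xs ≡ 0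
  countᵇ-none p []       none = refl
  countᵇ-none p (x ∷ xs) none rewrite none (here refl) = countᵇ-none p xs (none ∘ there)

  countᵇ-all : ∀ (p : A → Bool) xs → (∀ {x} → x ∈ xs → p x ≡ true) → countᵇ p xs ≡ length xs
  countᵇ-all p []       all = refl
  countᵇ-all p (x ∷ xs) all rewrite all (here refl) = cong suc (countᵇ-all p xs (all ∘ there))

  countᵇ-mono : ∀ (p q : A → Bool) xs → (∀ x → p x ≡ true → q x ≡ true) → countᵇ p xs ≤ countᵇ q xs
  countᵇ-mono p q []       p⇒q = z≤n
  countᵇ-mono p q (x ∷ xs) p⇒q with p x in px
  ... | true  rewrite p⇒q x px = s≤s (countᵇ-mono p q xs p⇒q)
  ... | false = ℕₚ.≤-trans (countᵇ-mono p q xs p⇒q) (ℕₚ.m≤n+m _ (indicator (q x)))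

  countᵇ-mono-< : ∀ (p q : A → Bool) xs {w} → (∀ x → p x ≡ true → q x ≡ true) →
    w ∈ xs → q w ≡ true → p w ≡ false → countᵇ p xs < countᵇ q xs
  countᵇ-mono-< p q (x ∷ xs) p⇒q (here refl) qw pw rewrite qw | pw = s≤s (countᵇ-mono p q xs p⇒q)
  countᵇ-mono-< p q (x ∷ xs) p⇒q (there w∈xs) qw pw with p x in px
  ... | true  rewrite p⇒q x px = s≤s (countᵇ-mono-< p q xs p⇒q w∈xs qw pw)
  ... | false = ℕₚ.≤-trans (countᵇ-mono-< p q xs p⇒q w∈xs qw pw) (ℕₚ.m≤n+m _ (indicator (q x)))

  length-filter≡countᵇ : ∀ {P : A → Set} (P? : ∀ x → Dec (P x)) xs →
    length (filter P? xs) ≡ countᵇ (does ∘ P?) xs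
  length-filter≡countᵇ P? [] = refl
  length-filter≡countᵇ P? (x ∷ xs) with P? x
  ... | yes _ = cong suc (length-filter≡countᵇ P? xs)
  ... | no  _ = length-filter≡countᵇ P? xs

module _ {A : Set} where

  ↭-from-same-members : ∀ {xs ys : List A} → Unique xs → Unique ys →
    (∀ {x} → x ∈ xs → x ∈ ys) → (∀ {x} → x ∈ ys → x ∈ xs) → xs ↭ ys
  ↭-from-same-members xs! ys! xs⊆ys ys⊆xs = ∼bag⇒↭ (unique∧set⇒bag xs! ys! (mk⇔ xs⊆ys ys⊆xs))

  Unique-resp-↭ : ∀ {xs ys : List A} → xs ↭ ys → Unique xs → Unique ys
  Unique-resp-↭ p = ↭ₛₚ.Unique-resp-↭ (setoid A) (↭⇒↭ₛ p)

  Unique-++⁻ˡ : ∀ xs {ys : List A} → Unique (xs ++ ys) → Unique xs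
  Unique-++⁻ˡ []       _          = []
  Unique-++⁻ˡ (x ∷ xs) (x∉ ∷ xs!) = Allₚ.++⁻ˡ xs x∉ ∷ Unique-++⁻ˡ xs xs!

  Unique-++⁻ʳ : ∀ xs {ys : List A} → Unique (xs ++ ys) → Unique ys
  Unique-++⁻ʳ []       ys!       = ys!
  Unique-++⁻ʳ (x ∷ xs) (_ ∷ xs!) = Unique-++⁻ʳ xs xs!

  Unique-++-disjoint : ∀ xs {ys : List A} {x} → Unique (xs ++ ys) → x ∈ xs → x ∈ ys → ⊥
  Unique-++-disjoint (x ∷ xs) xs! (here refl) x∈ys =
    Uniqueₚ.Unique[x∷xs]⇒x∉xs xs! (∈-++⁺ʳ xs x∈ys)
  Unique-++-disjoint (_ ∷ xs) (_ ∷ xs!) (there x∈xs) x∈ys = Unique-++-disjoint xs xs! x∈xs x∈ys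

module _ {n : ℕ} where

  countᵇ-allFin-↭ : ∀ (p : Fin n → Bool) {K} → Unique K → (∀ i → i ∈ K) →
    countᵇ p (allFin n) ≡ countᵇ p K
  countᵇ-allFin-↭ p K! K-complete = countᵇ-↭ p
    (↭-from-same-members (Uniqueₚ.allFin⁺ n) K! (λ {i} _ → K-complete i) (λ {i} _ → ∈-allFin i))

  countᵇ-allFin≡length : ∀ (p : Fin n → Bool) {S} → Unique S →
    (∀ {v} → p v ≡ true → v ∈ S) → (∀ {v} → v ∈ S → p v ≡ true) → countᵇ p (allFin n) ≡ length S
  countᵇ-allFin≡length p {S} S! p⇒S S⇒p = trans (sym (length-filter≡countᵇ (T? ∘ p) (allFin n)))
    (↭ₚ.↭-length (↭-from-same-members (Uniqueₚ.filter⁺ (T? ∘ p) (Uniqueₚ.allFin⁺ n)) S!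
      (λ m → p⇒S (Equivalence.to T-≡ (proj₂ (∈-filter⁻ (T? ∘ p) {xs = allFin n} m))))
      (λ {v} m → ∈-filter⁺ (T? ∘ p) (∈-allFin v) (Equivalence.from T-≡ (S⇒p m)))))

split-by-suffix-length : ∀ {A : Set} (xs : List A) k → k ≤ length xs →
  Σ (List A) λ pre → Σ (List A) λ post → pre ++ post ≡ xs × length post ≡ k
split-by-suffix-length xs k k≤ =
  take m xs , drop m xs , Listₚ.take++drop≡id m xs , trans (Listₚ.length-drop m xs) (ℕₚ.m∸[m∸n]≡n k≤)
  where
  m : ℕ
  m = length xs ∸ k

length-suffix-< : ∀ {A : Set} pre (x : A) post → length post < length (pre ++ x ∷ post)
length-suffix-< []        x post = ℕₚ.n<1+n (length post)
length-suffix-< (y ∷ pre) x post = ℕₚ.m<n⇒m<1+n (length-suffix-< pre x post)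

record IsStrictTotalᵇ {A : Set} (R : A → A → Bool) : Set where
  field
    asym  : ∀ {x y} → R x y ≡ true → R y x ≡ false
    total : ∀ {x y} → x ≢ y → R x y ≡ true ⊎ R y x ≡ true

  irrefl : ∀ x → R x x ≡ false
  irrefl x with R x x in Rxx
  ... | true  = trans (sym Rxx) (asym Rxx)
  ... | false = refl

flip-isStrictTotalᵇ : ∀ {A : Set} {R : A → A → Bool} → IsStrictTotalᵇ R → IsStrictTotalᵇ (flip R)
flip-isStrictTotalᵇ R-sto = record { asym = asym ; total = λ x≢y → Sum.swap (total x≢y) }
  where open IsStrictTotalᵇ R-sto

module Lehmer {A : Set} (_≟_ : DecidableEquality A) where

  lehmer : (A → A → Bool) → List A → A → ℕ
  lehmer R []       d = 0
  lehmer R (y ∷ ys) d = if does (y ≟ d) then countᵇ (flip R d) ys else lehmer R ys d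

  module _ (R : A → A → Bool) where

    lehmer-at : ∀ pre post d → d ∉ pre → lehmer R (pre ++ d ∷ post) d ≡ countᵇ (flip R d) post
    lehmer-at [] post d _ with d ≟ d
    ... | yes _ = refl
    ... | no d≢d = ⊥-elim (d≢d refl)
    lehmer-at (y ∷ pre) post d d∉ with y ≟ d
    ... | yes y≡d = ⊥-elim (d∉ (here (sym y≡d)))
    ... | no  _   = lehmer-at pre post d (d∉ ∘ there)

    lehmer-∷ʳ : ∀ L c {d} → d ∈ L → lehmer R (L ∷ʳ c) d ≡ lehmer R L d + indicator (R c d)
    lehmer-∷ʳ (y ∷ ys) c {d} d∈ with y ≟ d
    ... | yes _ = trans (countᵇ-++ (flip R d) ys [ c ]) (cong (countᵇ (flip R d) ys +_) (ℕₚ.+-identityʳ _))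
    lehmer-∷ʳ (y ∷ ys) c (here d≡y)   | no y≢d = ⊥-elim (y≢d (sym d≡y))
    lehmer-∷ʳ (y ∷ ys) c (there d∈ys) | no _   = lehmer-∷ʳ ys c d∈ys

    lehmer-∷ʳ-∉ : ∀ L c {d} → d ∉ L → lehmer R (L ∷ʳ c) d ≡ 0
    lehmer-∷ʳ-∉ [] c {d} _ with c ≟ d
    ... | yes _ = refl
    ... | no  _ = refl
    lehmer-∷ʳ-∉ (y ∷ ys) c {d} d∉ with y ≟ d
    ... | yes y≡d = ⊥-elim (d∉ (here (sym y≡d)))
    ... | no  _   = lehmer-∷ʳ-∉ ys c (d∉ ∘ there)

    lehmer≤countᵇ : ∀ L d → lehmer R L d ≤ countᵇ (flip R d) L
    lehmer≤countᵇ []       d = z≤n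
    lehmer≤countᵇ (y ∷ ys) d with y ≟ d
    ... | yes _ = ℕₚ.m≤n+m _ (indicator (R y d))
    ... | no  _ = ℕₚ.≤-trans (lehmer≤countᵇ ys d) (ℕₚ.m≤n+m _ (indicator (R y d)))

    lehmer-insert : ∀ pre post {x w} → x ≢ w → R x w ≡ false →
      lehmer R (pre ++ x ∷ post) w ≡ lehmer R (pre ++ post) w
    lehmer-insert [] post {x} {w} x≢w _ with x ≟ w
    ... | yes x≡w = ⊥-elim (x≢w x≡w)
    ... | no  _   = refl
    lehmer-insert (y ∷ pre) post {x} {w} x≢w Rxw with y ≟ w
    ... | yes _ rewrite countᵇ-++ (flip R w) pre (x ∷ post) | countᵇ-++ (flip R w) pre post | Rxw = refl
    ... | no  _ = lehmer-insert pre post x≢w Rxw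


    lehmer-∷ʳ-positive : ∀ L c {d} → d ∈ L → R c d ≡ true → 0 < lehmer R (L ∷ʳ c) d
    lehmer-∷ʳ-positive L c {d} d∈L Rcd = subst (0 <_)
      (sym (trans (lehmer-∷ʳ L c d∈L) (cong (λ b → lehmer R L d + indicator b) Rcd)))
      (ℕₚ.m≤n+m 1 (lehmer R L d))

    lehmer-∷ʳ-≢0⇒∈ : ∀ L c {d} → lehmer R (L ∷ʳ c) d ≢ 0 → d ∈ L
    lehmer-∷ʳ-≢0⇒∈ L c {d} ≢0 with DecMembership._∈?_ _≟_ d L
    ... | yes d∈L = d∈L
    ... | no  d∉L = ⊥-elim (≢0 (lehmer-∷ʳ-∉ L c d∉L))

  lehmer-∷-≢ : ∀ R {y d} L → y ≢ d → lehmer R (y ∷ L) d ≡ lehmer R L d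
  lehmer-∷-≢ R {y} {d} L y≢d with y ≟ d
  ... | yes y≡d = ⊥-elim (y≢d y≡d)
  ... | no  _   = refl

  module _ {R : A → A → Bool} (R-strictTotal : IsStrictTotalᵇ R) where
    open IsStrictTotalᵇ R-strictTotal

    countᵇ-below-∷ : ∀ {w x} xs → R w x ≡ true → countᵇ (flip R w) (x ∷ xs) ≡ countᵇ (flip R w) xs
    countᵇ-below-∷ {w} xs Rwx = cong (λ b → indicator b + countᵇ (flip R w) xs) (asym Rwx)

    countᵇ-below-self : ∀ {x} xs → All (λ y → R y x ≡ true) xs → countᵇ (flip R x) (x ∷ xs) ≡ length xs
    countᵇ-below-self {x} xs xs<x =
      trans (cong (λ b → indicator b + countᵇ (flip R x) xs) (irrefl x)) (countᵇ-all (flip R x) xs (All.lookup xs<x))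

    -- Insert the R-largest entry x so that exactly t x entries follow it; this leaves the codes
    -- of all other entries unchanged.
    lehmer-realise : ∀ L → AllPairs (λ x y → R y x ≡ true) L → (t : A → ℕ) →
      (∀ {w} → w ∈ L → t w ≤ countᵇ (flip R w) L) →
      Σ (List A) λ W → W ↭ L × (∀ {w} → w ∈ L → lehmer R W w ≡ t w)
    lehmer-realise [] _ t _ = [] , ↭-refl , λ ()
    lehmer-realise (x ∷ xs) (x>xs ∷ xs↓) t t≤
      with W′ , W′↭xs , lehmer-W′ ←
             lehmer-realise xs xs↓ t (λ m → subst (t _ ≤_) (countᵇ-below-∷ xs (All.lookup x>xs m)) (t≤ (there m)))
      with pre , post , pre++post≡W′ , |post|≡tx ←
             split-by-suffix-length W′ (t x)
               (subst (t x ≤_) (trans (countᵇ-below-self xs x>xs) (↭ₚ.↭-length (↭-sym W′↭xs))) (t≤ (here refl)))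
      = pre ++ x ∷ post , W↭x∷xs , lehmer-W
      where
      x∉xs : x ∉ xs
      x∉xs m with () ← trans (sym (All.lookup x>xs m)) (irrefl x)
      W↭x∷xs : pre ++ x ∷ post ↭ x ∷ xs
      W↭x∷xs = ↭-trans (↭ₚ.shift x pre post) (prep x (subst (_↭ xs) (sym pre++post≡W′) W′↭xs))
      post⊆xs : ∀ {y} → y ∈ post → y ∈ xs
      post⊆xs m = ↭ₚ.∈-resp-↭ W′↭xs (subst (_ ∈_) pre++post≡W′ (∈-++⁺ʳ pre m))
      lehmer-W : ∀ {w} → w ∈ x ∷ xs → lehmer R (pre ++ x ∷ post) w ≡ t w
      lehmer-W (here refl) = begin
        lehmer R (pre ++ x ∷ post) x ≡⟨ lehmer-at R pre post x (λ m → x∉xs (pre⊆xs m)) ⟩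
        countᵇ (flip R x) post      ≡⟨ countᵇ-all _ post (All.lookup x>xs ∘ post⊆xs) ⟩
        length post                 ≡⟨ |post|≡tx ⟩
        t x                         ∎
        where
        open ≡-Reasoning
        pre⊆xs : ∀ {y} → y ∈ pre → y ∈ xs
        pre⊆xs m = ↭ₚ.∈-resp-↭ W′↭xs (subst (_ ∈_) pre++post≡W′ (∈-++⁺ˡ m))
      lehmer-W {w} (there w∈xs) = begin
        lehmer R (pre ++ x ∷ post) w ≡⟨ lehmer-insert R pre post (λ x≡w → x∉xs (subst (_∈ xs) (sym x≡w) w∈xs))
                                                               (asym (All.lookup x>xs w∈xs)) ⟩
        lehmer R (pre ++ post) w     ≡⟨ cong (λ L → lehmer R L w) pre++post≡W′ ⟩
        lehmer R W′ w                ≡⟨ lehmer-W′ w∈xs ⟩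
        t w                          ∎
        where open ≡-Reasoning

    lehmer-head-< : ∀ {h₁ h₂ T₁ T₂} → h₁ ∷ T₁ ↭ h₂ ∷ T₂ → Unique (h₂ ∷ T₂) → h₁ ≢ h₂ → R h₂ h₁ ≡ true →
      lehmer R (h₂ ∷ T₂) h₁ < lehmer R (h₁ ∷ T₁) h₁
    lehmer-head-< {h₁} {h₂} {T₁} p u h₁≢h₂ Rh₂h₁ with ↭ₚ.∈-resp-↭ p (here refl)
    ... | here h₁≡h₂ = ⊥-elim (h₁≢h₂ h₁≡h₂)
    ... | there h₁∈T₂ with pre , post , refl ← ∈-∃++ h₁∈T₂ = begin-strict
      lehmer R (h₂ ∷ pre ++ h₁ ∷ post) h₁               ≡⟨ lehmer-∷-≢ R (pre ++ h₁ ∷ post) (h₁≢h₂ ∘ sym) ⟩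
      lehmer R (pre ++ h₁ ∷ post) h₁                    ≡⟨ lehmer-at R pre post h₁ h₁∉pre ⟩
      countᵇ (flip R h₁) post                           <⟨ s≤s (ℕₚ.m≤n+m _ (countᵇ (flip R h₁) pre)) ⟩
      1 + (countᵇ (flip R h₁) pre + countᵇ (flip R h₁) post)
        ≡⟨ cong₂ _+_ (cong indicator Rh₂h₁) (countᵇ-++ (flip R h₁) pre post) ⟨
      countᵇ (flip R h₁) (h₂ ∷ pre ++ post)             ≡⟨ countᵇ-↭ (flip R h₁) T₁↭ ⟨
      countᵇ (flip R h₁) T₁                             ≡⟨ lehmer-at R [] T₁ h₁ (λ ()) ⟨
      lehmer R (h₁ ∷ T₁) h₁                             ∎
      where
      open ℕₚ.≤-Reasoning
      h₁∉pre : h₁ ∉ pre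
      h₁∉pre m = Unique-++-disjoint pre (AllPairs.tail u) m (here refl)
      T₁↭ : T₁ ↭ h₂ ∷ pre ++ post
      T₁↭ = ↭ₚ.drop-∷ (↭-trans p (↭-trans (prep h₂ (↭ₚ.shift h₁ pre post)) (swap h₂ h₁ ↭-refl)))

    lehmer-injective : ∀ W₁ W₂ → Unique W₁ → W₁ ↭ W₂ →
      (∀ {w} → w ∈ W₁ → lehmer R W₁ w ≡ lehmer R W₂ w) → W₁ ≡ W₂
    lehmer-injective [] W₂ _ p _ = sym (↭ₚ.↭-empty-inv (↭-sym p))
    lehmer-injective (h₁ ∷ T₁) [] _ p _ with () ← ↭ₚ.↭-length p
    lehmer-injective (h₁ ∷ T₁) (h₂ ∷ T₂) u p same with h₁ ≟ h₂
    ... | yes refl = cong (h₁ ∷_) (lehmer-injective T₁ T₂ (AllPairs.tail u) (↭ₚ.drop-∷ p) same-tail)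
      where
      same-tail : ∀ {w} → w ∈ T₁ → lehmer R T₁ w ≡ lehmer R T₂ w
      same-tail {w} w∈T₁ =
        trans (sym (lehmer-∷-≢ R T₁ h₁≢w)) (trans (same (there w∈T₁)) (lehmer-∷-≢ R T₂ h₁≢w))
        where
        h₁≢w : h₁ ≢ w
        h₁≢w refl = Uniqueₚ.Unique[x∷xs]⇒x∉xs u w∈T₁
    ... | no h₁≢h₂ with total h₁≢h₂
    ... | inj₁ Rh₁h₂ = ⊥-elim (ℕₚ.<-irrefl (same (↭ₚ.∈-resp-↭ (↭-sym p) (here refl)))
                                          (lehmer-head-< (↭-sym p) u (h₁≢h₂ ∘ sym) Rh₁h₂))
    ... | inj₂ Rh₂h₁ = ⊥-elim (ℕₚ.<-irrefl (sym (same (here refl)))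
                                          (lehmer-head-< p (Unique-resp-↭ p u) h₁≢h₂ Rh₂h₁))

Cell : Set
Cell = ℕ × ℕ

module _ {n : ℕ} where

  -- Cells are (row , column).  A column is listed top to bottom and a row right to left, so in
  -- both cases the entries after d in the list are those below, resp. left of, d.
  columnCells : List (Fin n) → List (Fin n × Cell)
  columnCells []       = []
  columnCells (x ∷ xs) = (x , (2 + length xs , 1)) ∷ columnCells xs

  rowCells : List (Fin n) → List (Fin n × Cell)
  rowCells = map (map₂ Product.swap) ∘ columnCells

  hookCells : Fin n → List (Fin n) → List (Fin n) → List (Fin n × Cell)
  hookCells c A B = (c , (1 , 1)) ∷ columnCells A ++ rowCells B

  keys-columnCells : ∀ L → map proj₁ (columnCells L) ≡ L
  keys-columnCells []       = refl
  keys-columnCells (x ∷ xs) = cong (x ∷_) (keys-columnCells xs)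

  keys-hookCells : ∀ c A B → map proj₁ (hookCells c A B) ≡ c ∷ A ++ B
  keys-hookCells c A B = cong (c ∷_) (begin
    map proj₁ (columnCells A ++ rowCells B)             ≡⟨ Listₚ.map-++ proj₁ (columnCells A) (rowCells B) ⟩
    map proj₁ (columnCells A) ++ map proj₁ (rowCells B) ≡⟨ cong (map proj₁ (columnCells A) ++_)
                                                              (Listₚ.map-∘ (columnCells B)) ⟨
    map proj₁ (columnCells A) ++ map proj₁ (columnCells B)
      ≡⟨ cong₂ _++_ (keys-columnCells A) (keys-columnCells B) ⟩
    A ++ B                                              ∎)
    where open ≡-Reasoning

  ∈-rowCells⁻ : ∀ L {k v} → (k , v) ∈ rowCells L → (k , Product.swap v) ∈ columnCells L
  ∈-rowCells⁻ L m with _ , m′ , refl ← ∈-map⁻ (map₂ Product.swap) m = m′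

  ∈-rowCells⁺ : ∀ L {k v} → (k , v) ∈ columnCells L → (k , Product.swap v) ∈ rowCells L
  ∈-rowCells⁺ L = ∈-map⁺ (map₂ Product.swap)

  ∈-columnCells⁻ : ∀ L {k v} → (k , v) ∈ columnCells L →
    k ∈ L × 2 ≤ proj₁ v × proj₁ v ≤ suc (length L) × proj₂ v ≡ 1
  ∈-columnCells⁻ (x ∷ xs) (here refl) = here refl , s≤s (s≤s z≤n) , ℕₚ.≤-refl , refl
  ∈-columnCells⁻ (x ∷ xs) (there m) with k∈xs , 2≤ , ≤len , q≡1 ← ∈-columnCells⁻ xs m =
    there k∈xs , 2≤ , ℕₚ.m≤n⇒m≤1+n ≤len , q≡1

  columnCells-injective : ∀ L {i j v} → (i , v) ∈ columnCells L → (j , v) ∈ columnCells L → i ≡ j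
  columnCells-injective (x ∷ xs) (here refl) (here refl) = refl
  columnCells-injective (x ∷ xs) (here refl) (there m)
    with _ , _ , p≤ , _ ← ∈-columnCells⁻ xs m = ⊥-elim (ℕₚ.1+n≰n p≤)
  columnCells-injective (x ∷ xs) (there m) (here refl)
    with _ , _ , p≤ , _ ← ∈-columnCells⁻ xs m = ⊥-elim (ℕₚ.1+n≰n p≤)
  columnCells-injective (x ∷ xs) (there m) (there m′) = columnCells-injective xs m m′

  columnCells-surjective : ∀ L j → j < length L → ∃ λ i → (i , (2 + j , 1)) ∈ columnCells L
  columnCells-surjective (x ∷ xs) j (s≤s j≤) with j ℕ.≟ length xs
  ... | yes refl = x , here refl
  ... | no  j≢   = Product.map₂ there (columnCells-surjective xs j (ℕₚ.≤∧≢⇒< j≤ j≢))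

  ∈-columnCells-at : ∀ pre x post → (x , (2 + length post , 1)) ∈ columnCells (pre ++ x ∷ post)
  ∈-columnCells-at []        x post = here refl
  ∈-columnCells-at (y ∷ pre) x post = there (∈-columnCells-at pre x post)

  -- The default (0 , 0) is junk: it is only looked up at keys that occur.
  lookupCell : List (Fin n × Cell) → Fin n → Cell
  lookupCell []            i = (0 , 0)
  lookupCell ((k , v) ∷ T) i = if does (k Fin.≟ i) then v else lookupCell T i

  lookupCell-∈ : ∀ T {k v} → Unique (map proj₁ T) → (k , v) ∈ T → lookupCell T k ≡ v
  lookupCell-∈ ((k , v) ∷ T) _ (here refl) with k Fin.≟ k
  ... | yes _   = refl
  ... | no  k≢k = ⊥-elim (k≢k refl)
  lookupCell-∈ ((k′ , v′) ∷ T) {k} u (there m) with k′ Fin.≟ k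
  ... | yes refl = ⊥-elim (Uniqueₚ.Unique[x∷xs]⇒x∉xs u (∈-map⁺ proj₁ m))
  ... | no  _    = lookupCell-∈ T (AllPairs.tail u) m

  ∈-lookupCell : ∀ T {k} → k ∈ map proj₁ T → (k , lookupCell T k) ∈ T
  ∈-lookupCell ((k′ , v′) ∷ T) {k} m with k′ Fin.≟ k
  ... | yes refl = here refl
  ∈-lookupCell ((k′ , v′) ∷ T) (here k≡k′) | no k′≢k = ⊥-elim (k′≢k (sym k≡k′))
  ∈-lookupCell ((k′ , v′) ∷ T) (there m)   | no _    = there (∈-lookupCell T m)

  open Lehmer (Fin._≟_ {n})

  _<ᵇ_ _>ᵇ_ : Fin n → Fin n → Bool
  i <ᵇ j = does (toℕ i <? toℕ j)
  _>ᵇ_ = flip _<ᵇ_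

  <ᵇ-isStrictTotal : IsStrictTotalᵇ _<ᵇ_
  <ᵇ-isStrictTotal = record
    { asym  = λ {x} {y} x<y →
        dec-false (toℕ y <? toℕ x) (ℕₚ.<-asym (ℕₚ.<ᵇ⇒< (toℕ x) (toℕ y) (Equivalence.from T-≡ x<y)))
    ; total = total
    }
    where
    total : ∀ {x y} → x ≢ y → x <ᵇ y ≡ true ⊎ y <ᵇ x ≡ true
    total {x} {y} x≢y with ℕₚ.<-cmp (toℕ x) (toℕ y)
    ... | tri< x<y _ _ = inj₁ (dec-true (toℕ x <? toℕ y) x<y)
    ... | tri≈ _ x≡y _ = ⊥-elim (x≢y (Finₚ.toℕ-injective x≡y))
    ... | tri> _ _ y<x = inj₂ (dec-true (toℕ y <? toℕ x) y<x)

  -- The predicate counted by xExp; on transposed cells, the one counted by yExp.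
  invertedBelow : (Fin n → Fin n → Bool) → Fin n → Cell → Cell → Fin n → Bool
  invertedBelow R d cd ck k =
    does (proj₂ cd ℕ.≟ 1) ∧ (does (proj₂ ck ℕ.≟ 1) ∧ (does (proj₁ ck <? proj₁ cd) ∧ R k d))

  module _ (R : Fin n → Fin n → Bool) (d : Fin n) where

    countBelow : Cell → List (Fin n × Cell) → ℕ
    countBelow cd = countᵇ (λ e → invertedBelow R d cd (proj₂ e) (proj₁ e))

    countBelow-rowCells : ∀ cd L → countBelow cd (rowCells L) ≡ 0
    countBelow-rowCells cd []       = refl
    countBelow-rowCells cd (x ∷ xs) rewrite ∧-zeroʳ (does (proj₂ cd ℕ.≟ 1)) = countBelow-rowCells cd xs

    countBelow-corner : ∀ L → countBelow (1 , 1) (columnCells L) ≡ 0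
    countBelow-corner []       = refl
    countBelow-corner (x ∷ xs) = countBelow-corner xs

    countBelow-under : ∀ s L → length L ≤ s → countBelow (2 + s , 1) (columnCells L) ≡ countᵇ (flip R d) L
    countBelow-under s []       _ = refl
    countBelow-under s (x ∷ xs) |x∷xs|≤s
      rewrite dec-true (2 + length xs <? 2 + s) (s≤s (s≤s |x∷xs|≤s)) =
      cong (indicator (R x d) +_) (countBelow-under s xs (ℕₚ.<⇒≤ |x∷xs|≤s))

    countBelow-at : ∀ pre post → countBelow (2 + length post , 1) (columnCells (pre ++ d ∷ post)) ≡ countᵇ (flip R d) post
    countBelow-at [] post
      rewrite dec-false (2 + length post <? 2 + length post) (ℕₚ.<-irrefl refl) =
      countBelow-under (length post) post ℕₚ.≤-refl
    countBelow-at (y ∷ pre) post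
      rewrite dec-false (2 + length (pre ++ d ∷ post) <? 2 + length post)
                        (ℕₚ.≤⇒≯ (s≤s (s≤s (ℕₚ.<⇒≤ (length-suffix-< pre d post))))) =
      countBelow-at pre post

  module _ (R : Fin n → Fin n → Bool) {c : Fin n} {A B : List (Fin n)} (keys! : Unique (c ∷ A ++ B))
           (pos : Fin n → Cell) (pos-hookCells : ∀ {k v} → (k , v) ∈ hookCells c A B → pos k ≡ v) where

    private
      countBelow-hookCells-split : ∀ d cd → countBelow R d cd (hookCells c A B) ≡
        indicator (invertedBelow R d cd (1 , 1) c) + countBelow R d cd (columnCells A)
      countBelow-hookCells-split d cd = cong (indicator (invertedBelow R d cd (1 , 1) c) +_) (begin
        countBelow R d cd (columnCells A ++ rowCells B)
          ≡⟨ countᵇ-++ (λ e → invertedBelow R d cd (proj₂ e) (proj₁ e)) (columnCells A) (rowCells B) ⟩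
        countBelow R d cd (columnCells A) + countBelow R d cd (rowCells B)
          ≡⟨ cong (countBelow R d cd (columnCells A) +_) (countBelow-rowCells R d cd B) ⟩
        countBelow R d cd (columnCells A) + 0
          ≡⟨ ℕₚ.+-identityʳ _ ⟩
        countBelow R d cd (columnCells A) ∎)
        where open ≡-Reasoning

      A! : Unique A
      A! = Unique-++⁻ˡ A (AllPairs.tail keys!)

      c∉A : c ∉ A
      c∉A m = Uniqueₚ.Unique[x∷xs]⇒x∉xs keys! (∈-++⁺ˡ m)

    countBelow-hookCells : ∀ {d} → d ∈ c ∷ A ++ B → countBelow R d (pos d) (hookCells c A B) ≡ lehmer R (A ∷ʳ c) d
    countBelow-hookCells (here refl) = begin
      countBelow R c (pos c) (hookCells c A B) ≡⟨ cong (λ cd → countBelow R c cd (hookCells c A B))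
                                                       (pos-hookCells (here refl)) ⟩
      countBelow R c (1 , 1) (hookCells c A B) ≡⟨ countBelow-hookCells-split c (1 , 1) ⟩
      countBelow R c (1 , 1) (columnCells A)   ≡⟨ countBelow-corner R c A ⟩
      0                                        ≡⟨ lehmer-∷ʳ-∉ R A c c∉A ⟨
      lehmer R (A ∷ʳ c) c                      ∎
      where open ≡-Reasoning
    countBelow-hookCells {d} (there d∈A++B) with ∈-++⁻ A d∈A++B
    ... | inj₁ d∈A with pre , post , refl ← ∈-∃++ d∈A = begin
      countBelow R d (pos d) (hookCells c A B)
        ≡⟨ cong (λ cd → countBelow R d cd (hookCells c A B))
                (pos-hookCells (there (∈-++⁺ˡ (∈-columnCells-at pre d post)))) ⟩
      countBelow R d (2 + length post , 1) (hookCells c A B)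
        ≡⟨ countBelow-hookCells-split d (2 + length post , 1) ⟩
      indicator (R c d) + countBelow R d (2 + length post , 1) (columnCells A)
        ≡⟨ cong (indicator (R c d) +_) (countBelow-at R d pre post) ⟩
      indicator (R c d) + countᵇ (flip R d) post
        ≡⟨ ℕₚ.+-comm (indicator (R c d)) _ ⟩
      countᵇ (flip R d) post + indicator (R c d)
        ≡⟨ cong (_+ indicator (R c d)) (lehmer-at R pre post d (λ m → Unique-++-disjoint pre A! m (here refl))) ⟨
      lehmer R A d + indicator (R c d)
        ≡⟨ lehmer-∷ʳ R A c d∈A ⟨
      lehmer R (A ∷ʳ c) d ∎
      where open ≡-Reasoning
    ... | inj₂ d∈B with pre , post , refl ← ∈-∃++ d∈B = begin
      countBelow R d (pos d) (hookCells c A B)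
        ≡⟨ cong (λ cd → countBelow R d cd (hookCells c A B))
                (pos-hookCells (there (∈-++⁺ʳ (columnCells A) (∈-rowCells⁺ B (∈-columnCells-at pre d post))))) ⟩
      countBelow R d (1 , 2 + length post) (hookCells c A B)
        ≡⟨ countᵇ-none _ (hookCells c A B) (λ _ → refl) ⟩
      0
        ≡⟨ lehmer-∷ʳ-∉ R A c (λ d∈A → Unique-++-disjoint A (AllPairs.tail keys!) d∈A d∈B) ⟨
      lehmer R (A ∷ʳ c) d ∎
      where open ≡-Reasoning

    countᵇ-invertedBelow : (∀ i → i ∈ c ∷ A ++ B) → ∀ d →
      countᵇ (λ k → invertedBelow R d (pos d) (pos k) k) (allFin n) ≡ lehmer R (A ∷ʳ c) d
    countᵇ-invertedBelow complete d = begin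
      countᵇ P (allFin n)                      ≡⟨ countᵇ-allFin-↭ P keys! complete ⟩
      countᵇ P (c ∷ A ++ B)                    ≡⟨ cong (countᵇ P) (keys-hookCells c A B) ⟨
      countᵇ P (map proj₁ (hookCells c A B))   ≡⟨ countᵇ-map P proj₁ (hookCells c A B) ⟩
      countᵇ (P ∘ proj₁) (hookCells c A B)     ≡⟨ countᵇ-cong (P ∘ proj₁) _ (hookCells c A B)
                                                    (λ m → cong (λ v → invertedBelow R d (pos d) v _) (pos-hookCells m)) ⟩
      countBelow R d (pos d) (hookCells c A B) ≡⟨ countBelow-hookCells (complete d) ⟩
      lehmer R (A ∷ʳ c) d                      ∎
      where
      open ≡-Reasoning
      P : Fin n → Bool
      P k = invertedBelow R d (pos d) (pos k) k

  module HookFilling {r h : ℕ} (c : Fin n) (A B : List (Fin n))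
                     (keys! : Unique (c ∷ A ++ B)) (keys-complete : ∀ i → i ∈ c ∷ A ++ B)
                     (|A|+1≡h : suc (length A) ≡ h) (|B|+1≡r : suc (length B) ≡ r) where

    private
      cells : List (Fin n × Cell)
      cells = hookCells c A B

      cellKeys! : Unique (map proj₁ cells)
      cellKeys! = subst Unique (sym (keys-hookCells c A B)) keys!

      pos-cells : ∀ {k v} → (k , v) ∈ cells → lookupCell cells k ≡ v
      pos-cells = lookupCell-∈ cells cellKeys!

      ∈-cells : ∀ k → (k , lookupCell cells k) ∈ cells
      ∈-cells k = ∈-lookupCell cells (subst (k ∈_) (sym (keys-hookCells c A B)) (keys-complete k))

      cells-inHook : ∀ {k v} → (k , v) ∈ cells → InHook r h v
      cells-inHook (here refl) = inj₁ (refl , s≤s z≤n , subst (1 ≤_) |B|+1≡r (s≤s z≤n))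
      cells-inHook (there m) with ∈-++⁻ (columnCells A) m
      ... | inj₁ m′ with _ , 2≤p , p≤ , q≡1 ← ∈-columnCells⁻ A m′ =
        inj₂ (q≡1 , ℕₚ.<⇒≤ 2≤p , subst (_ ≤_) |A|+1≡h p≤)
      ... | inj₂ m′ with _ , 2≤q , q≤ , p≡1 ← ∈-columnCells⁻ B (∈-rowCells⁻ B m′) =
        inj₁ (p≡1 , ℕₚ.<⇒≤ 2≤q , subst (_ ≤_) |B|+1≡r q≤)

      corner-only : ∀ {k v} → (k , v) ∈ columnCells A ++ rowCells B → v ≢ (1 , 1)
      corner-only m refl with ∈-++⁻ (columnCells A) m
      ... | inj₁ m′ with s≤s () ← proj₁ (proj₂ (∈-columnCells⁻ A m′))
      ... | inj₂ m′ with s≤s () ← proj₁ (proj₂ (∈-columnCells⁻ B (∈-rowCells⁻ B m′)))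

      column≢row : ∀ {i j v} → (i , v) ∈ columnCells A → (j , v) ∈ rowCells B → ⊥
      column≢row col row with _ , _ , _ , q≡1 ← ∈-columnCells⁻ A col
                            | _ , 2≤q , _ , _ ← ∈-columnCells⁻ B (∈-rowCells⁻ B row) =
        ℕₚ.1+n≰n (subst (2 ≤_) q≡1 2≤q)

      cells-injective : ∀ {i j v} → (i , v) ∈ cells → (j , v) ∈ cells → i ≡ j
      cells-injective (here refl) (here refl) = refl
      cells-injective (here refl) (there m)   = ⊥-elim (corner-only m refl)
      cells-injective (there m)   (here refl) = ⊥-elim (corner-only m refl)
      cells-injective (there m)   (there m′) with ∈-++⁻ (columnCells A) m | ∈-++⁻ (columnCells A) m′
      ... | inj₁ col | inj₁ col′ = columnCells-injective A col col′
      ... | inj₂ row | inj₂ row′ = columnCells-injective B (∈-rowCells⁻ B row) (∈-rowCells⁻ B row′)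
      ... | inj₁ col | inj₂ row′ = ⊥-elim (column≢row col row′)
      ... | inj₂ row | inj₁ col′ = ⊥-elim (column≢row col′ row)

      cells-surjective : ∀ v → InHook r h v → ∃ λ i → lookupCell cells i ≡ v
      cells-surjective (_ , 0) (inj₁ (_ , () , _))
      cells-surjective (_ , 1) (inj₁ (refl , _ , _)) = c , pos-cells (here refl)
      cells-surjective (_ , suc (suc j)) (inj₁ (refl , _ , q≤r))
        with i , m ← columnCells-surjective B j (ℕₚ.≤-pred (subst (2 + j ≤_) (sym |B|+1≡r) q≤r)) =
        i , pos-cells (there (∈-++⁺ʳ (columnCells A) (∈-rowCells⁺ B m)))
      cells-surjective (0 , _) (inj₂ (_ , () , _))
      cells-surjective (1 , _) (inj₂ (refl , _ , _)) = c , pos-cells (here refl)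
      cells-surjective (suc (suc j) , _) (inj₂ (refl , _ , p≤h))
        with i , m ← columnCells-surjective A j (ℕₚ.≤-pred (subst (2 + j ≤_) (sym |A|+1≡h) p≤h)) =
        i , pos-cells (there (∈-++⁺ˡ m))

    filling : Filling n r h
    filling = record
      { pos    = lookupCell cells
      ; inHook = λ i → cells-inHook (∈-cells i)
      ; inj    = λ i j eq → cells-injective (∈-cells i) (subst (λ v → (j , v) ∈ cells) (sym eq) (∈-cells j))
      ; surj   = cells-surjective
      }

    private
      transposed! : Unique (c ∷ B ++ A)
      transposed! = Unique-resp-↭ (prep c (↭ₚ.++-comm A B)) keys!

      transposed-complete : ∀ i → i ∈ c ∷ B ++ A
      transposed-complete i = ↭ₚ.∈-resp-↭ (prep c (↭ₚ.++-comm A B)) (keys-complete i)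

      transposed-cells : ∀ {k v} → (k , v) ∈ hookCells c B A → Product.swap (lookupCell cells k) ≡ v
      transposed-cells (here refl) = cong Product.swap (pos-cells (here refl))
      transposed-cells (there m) with ∈-++⁻ (columnCells B) m
      ... | inj₁ col = cong Product.swap (pos-cells (there (∈-++⁺ʳ (columnCells A) (∈-rowCells⁺ B col))))
      ... | inj₂ row = cong Product.swap (pos-cells (there (∈-++⁺ˡ (∈-rowCells⁻ A row))))

    φ-filling : φ filling ≡ monoP (tabulate (lehmer _<ᵇ_ (A ∷ʳ c)) , tabulate (lehmer _>ᵇ_ (B ∷ʳ c)))
    φ-filling = cong monoP (cong₂ _,_ (Vecₚ.tabulate-cong xExp-filling) (Vecₚ.tabulate-cong yExp-filling))
      where
      xExp-filling : ∀ d → xExp filling d ≡ lehmer _<ᵇ_ (A ∷ʳ c) d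
      xExp-filling d = trans (length-filter≡countᵇ _ (allFin n))
        (countᵇ-invertedBelow _<ᵇ_ {c} {A} {B} keys! (lookupCell cells) pos-cells keys-complete d)
      yExp-filling : ∀ d → yExp filling d ≡ lehmer _>ᵇ_ (B ∷ʳ c) d
      yExp-filling d = trans (length-filter≡countᵇ _ (allFin n))
        (countᵇ-invertedBelow _>ᵇ_ {c} {B} {A} transposed! (Product.swap ∘ lookupCell cells) transposed-cells
                              transposed-complete d)

AllPairs-reverse⁺ : ∀ {A : Set} {R : A → A → Set} {xs} → AllPairs R xs → AllPairs (flip R) (reverse xs)
AllPairs-reverse⁺ {xs = []} [] = []
AllPairs-reverse⁺ {R = R} {xs = x ∷ xs} (x~xs ∷ xs!) = subst (AllPairs (flip R)) (sym (Listₚ.unfold-reverse x xs))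
  (AllPairsₚ.++⁺ (AllPairs-reverse⁺ xs!) ([] ∷ [])
                 (All.tabulate (λ m → All.lookup x~xs (↭ₚ.∈-resp-↭ (↭ₚ.↭-reverse xs) m) ∷ [])))

module _ {n : ℕ} where
  open Lehmer (Fin._≟_ {n})
  open DecMembership (Fin._≟_ {n}) using (_∈?_)

  allFin-ascending : AllPairs (λ i j → toℕ i < toℕ j) (allFin n)
  allFin-ascending = AllPairsₚ.tabulate⁺-< (λ i<j → i<j)

  allFin-descending : AllPairs (λ i j → toℕ j < toℕ i) (reverse (allFin n))
  allFin-descending = AllPairs-reverse⁺ allFin-ascending

  module _ {R : Fin n → Fin n → Bool} (R-strictTotal : IsStrictTotalᵇ R)
           {Ref : List (Fin n)} (Ref! : Unique Ref) (Ref-complete : ∀ i → i ∈ Ref)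
           (Ref-sorted : AllPairs (λ x y → R y x ≡ true) Ref) where

    lehmer-replace-last : ∀ L c₀ c → Unique (c₀ ∷ L) →
      (∀ {w} → w ∈ c₀ ∷ L → indicator (R c w) ≤ lehmer R (L ∷ʳ c₀) w) →
      Σ (List (Fin n)) λ B → B ↭ c₀ ∷ L × (∀ w → lehmer R (B ∷ʳ c) w ≡ lehmer R (L ∷ʳ c₀) w)
    lehmer-replace-last L c₀ c c₀∷L! c-admissible = B , B↭c₀∷L , lehmer-B∷ʳc
      where
      sorted : List (Fin n)
      sorted = filter (_∈? (c₀ ∷ L)) Ref

      sorted↭c₀∷L : sorted ↭ c₀ ∷ L
      sorted↭c₀∷L = ↭-from-same-members (Uniqueₚ.filter⁺ (_∈? (c₀ ∷ L)) Ref!) c₀∷L!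
        (λ m → proj₂ (∈-filter⁻ (_∈? (c₀ ∷ L)) {xs = Ref} m))
        (λ m → ∈-filter⁺ (_∈? (c₀ ∷ L)) (Ref-complete _) m)

      target : Fin n → ℕ
      target w = lehmer R (L ∷ʳ c₀) w ∸ indicator (R c w)

      target-bounded : ∀ {w} → w ∈ sorted → target w ≤ countᵇ (flip R w) sorted
      target-bounded {w} _ = begin
        target w                           ≤⟨ ℕₚ.m∸n≤m _ (indicator (R c w)) ⟩
        lehmer R (L ∷ʳ c₀) w               ≤⟨ lehmer≤countᵇ R (L ∷ʳ c₀) w ⟩
        countᵇ (flip R w) (L ∷ʳ c₀)        ≡⟨ countᵇ-↭ (flip R w) (↭ₚ.∷↭∷ʳ c₀ L) ⟨
        countᵇ (flip R w) (c₀ ∷ L)         ≡⟨ countᵇ-↭ (flip R w) sorted↭c₀∷L ⟨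
        countᵇ (flip R w) sorted           ∎
        where open ℕₚ.≤-Reasoning

      realised : Σ (List (Fin n)) λ W → W ↭ sorted × (∀ {w} → w ∈ sorted → lehmer R W w ≡ target w)
      realised = lehmer-realise R-strictTotal sorted (AllPairsₚ.filter⁺ (_∈? (c₀ ∷ L)) Ref-sorted) target target-bounded

      B : List (Fin n)
      B = proj₁ realised

      B↭c₀∷L : B ↭ c₀ ∷ L
      B↭c₀∷L = ↭-trans (proj₁ (proj₂ realised)) sorted↭c₀∷L

      lehmer-B∷ʳc : ∀ w → lehmer R (B ∷ʳ c) w ≡ lehmer R (L ∷ʳ c₀) w
      lehmer-B∷ʳc w with w ∈? B
      ... | yes w∈B = begin
        lehmer R (B ∷ʳ c) w                ≡⟨ lehmer-∷ʳ R B c w∈B ⟩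
        lehmer R B w + indicator (R c w)   ≡⟨ cong (_+ indicator (R c w))
                                                   (proj₂ (proj₂ realised) (↭ₚ.∈-resp-↭ (proj₁ (proj₂ realised)) w∈B)) ⟩
        target w + indicator (R c w)       ≡⟨ ℕₚ.m∸n+n≡m (c-admissible (↭ₚ.∈-resp-↭ B↭c₀∷L w∈B)) ⟩
        lehmer R (L ∷ʳ c₀) w               ∎
        where open ≡-Reasoning
      ... | no w∉B = trans (lehmer-∷ʳ-∉ R B c w∉B)
        (sym (lehmer-∷ʳ-∉ R L c₀ (λ w∈L → w∉B (↭ₚ.∈-resp-↭ (↭-sym B↭c₀∷L) (there w∈L)))))

record Arrangement (n a ℓ : ℕ) : Set where
  field
    c c′             : Fin n
    A D              : List (Fin n)
    c<c′             : toℕ c < toℕ c′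
    entries!         : Unique (c ∷ c′ ∷ A ++ D)
    entries-complete : ∀ i → i ∈ c ∷ c′ ∷ A ++ D
    |A|≡ℓ            : length A ≡ ℓ
    |D|≡a            : length D ≡ a

module _ {n : ℕ} where
  open Lehmer (Fin._≟_ {n})

  -- With threshold c this recognises the column c ∷ A of an arrangement from its exponents alone,
  -- and the number of entries it selects grows with the threshold: this determines c.
  inColumnᵇ : (Fin n → ℕ) → (Fin n → ℕ) → Fin n → Fin n → Bool
  inColumnᵇ X Y t v = if does (X v ℕ.≟ 0) then does (Y v ℕ.≟ 0) ∧ does (toℕ v ≤? toℕ t) else true

  module _ (X Y : Fin n → ℕ) where

    inColumnᵇ-X≢0 : ∀ t {v} → X v ≢ 0 → inColumnᵇ X Y t v ≡ true
    inColumnᵇ-X≢0 t {v} X≢0 rewrite dec-false (X v ℕ.≟ 0) X≢0 = refl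

    inColumnᵇ-zeros : ∀ {t v} → X v ≡ 0 → Y v ≡ 0 → toℕ v ≤ toℕ t → inColumnᵇ X Y t v ≡ true
    inColumnᵇ-zeros {t} {v} X≡0 Y≡0 v≤t
      rewrite dec-true (X v ℕ.≟ 0) X≡0 | dec-true (Y v ℕ.≟ 0) Y≡0 | dec-true (toℕ v ≤? toℕ t) v≤t = refl

    inColumnᵇ-above : ∀ {t v} → X v ≡ 0 → toℕ t < toℕ v → inColumnᵇ X Y t v ≡ false
    inColumnᵇ-above {t} {v} X≡0 t<v
      rewrite dec-true (X v ℕ.≟ 0) X≡0 | dec-false (toℕ v ≤? toℕ t) (ℕₚ.<⇒≱ t<v) = ∧-zeroʳ _

    inColumnᵇ-Y≢0 : ∀ {t v} → X v ≡ 0 → Y v ≢ 0 → inColumnᵇ X Y t v ≡ false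
    inColumnᵇ-Y≢0 {t} {v} X≡0 Y≢0 rewrite dec-true (X v ℕ.≟ 0) X≡0 | dec-false (Y v ℕ.≟ 0) Y≢0 = refl

    inColumnᵇ-true : ∀ {t v} → inColumnᵇ X Y t v ≡ true → X v ≢ 0 ⊎ (X v ≡ 0 × Y v ≡ 0 × toℕ v ≤ toℕ t)
    inColumnᵇ-true {t} {v} eq with X v ℕ.≟ 0 | Y v ℕ.≟ 0 | toℕ v ≤? toℕ t
    ... | no  X≢0 | _         | _       = inj₁ X≢0
    ... | yes X≡0 | yes Y≡0   | yes v≤t = inj₂ (X≡0 , Y≡0 , v≤t)
    ... | yes X≡0 | yes _     | no  v≰t with () ← trans (sym eq) (inColumnᵇ-above X≡0 (ℕₚ.≰⇒> v≰t))
    ... | yes X≡0 | no  Y≢0   | _       with () ← trans (sym eq) (inColumnᵇ-Y≢0 X≡0 Y≢0)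

    inColumnᵇ-mono : ∀ {t t′} v → toℕ t ≤ toℕ t′ → inColumnᵇ X Y t v ≡ true → inColumnᵇ X Y t′ v ≡ true
    inColumnᵇ-mono {t′ = t′} v t≤t′ eq with inColumnᵇ-true eq
    ... | inj₁ X≢0               = inColumnᵇ-X≢0 t′ X≢0
    ... | inj₂ (X≡0 , Y≡0 , v≤t) = inColumnᵇ-zeros X≡0 Y≡0 (ℕₚ.≤-trans v≤t t≤t′)

  inColumnᵇ-cong : ∀ {X Y X′ Y′} t → (∀ w → X w ≡ X′ w) → (∀ w → Y w ≡ Y′ w) →
    ∀ v → inColumnᵇ X Y t v ≡ inColumnᵇ X′ Y′ t v
  inColumnᵇ-cong t X≗X′ Y≗Y′ v rewrite X≗X′ v | Y≗Y′ v = refl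

module _ {n a ℓ : ℕ} where
  open Lehmer (Fin._≟_ {n})

  module ArrangementFacts (g : Arrangement n a ℓ) where
    open Arrangement g public

    X Y : Fin n → ℕ
    X = lehmer _<ᵇ_ (A ∷ʳ c)
    Y = lehmer _>ᵇ_ (D ∷ʳ c′)

    monomial : Mono n
    monomial = tabulate X , tabulate Y

    c∉A : c ∉ A
    c∉A = Uniqueₚ.Unique[x∷xs]⇒x∉xs entries! ∘ there ∘ ∈-++⁺ˡ

    c∉D : c ∉ D
    c∉D = Uniqueₚ.Unique[x∷xs]⇒x∉xs entries! ∘ there ∘ ∈-++⁺ʳ A

    c′∉A : c′ ∉ A
    c′∉A = Uniqueₚ.Unique[x∷xs]⇒x∉xs (AllPairs.tail entries!) ∘ ∈-++⁺ˡ

    c′∉D : c′ ∉ D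
    c′∉D = Uniqueₚ.Unique[x∷xs]⇒x∉xs (AllPairs.tail entries!) ∘ ∈-++⁺ʳ A

    A∩D≡∅ : ∀ {v} → v ∈ A → v ∈ D → ⊥
    A∩D≡∅ = Unique-++-disjoint A (AllPairs.tail (AllPairs.tail entries!))

    A! : Unique A
    A! = Unique-++⁻ˡ A (AllPairs.tail (AllPairs.tail entries!))

    D! : Unique D
    D! = Unique-++⁻ʳ A (AllPairs.tail (AllPairs.tail entries!))

    X≢0⇒∈A : ∀ {v} → X v ≢ 0 → v ∈ A
    X≢0⇒∈A = lehmer-∷ʳ-≢0⇒∈ _<ᵇ_ A c

    Y≢0⇒∈D : ∀ {v} → Y v ≢ 0 → v ∈ D
    Y≢0⇒∈D = lehmer-∷ʳ-≢0⇒∈ _>ᵇ_ D c′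

    X-positive : ∀ {v} → v ∈ A → toℕ c < toℕ v → 0 < X v
    X-positive {v} v∈A c<v = lehmer-∷ʳ-positive _<ᵇ_ A c v∈A (dec-true (toℕ c <? toℕ v) c<v)

    Y-positive : ∀ {v} → v ∈ D → toℕ v < toℕ c′ → 0 < Y v
    Y-positive {v} v∈D v<c′ = lehmer-∷ʳ-positive _>ᵇ_ D c′ v∈D (dec-true (toℕ v <? toℕ c′) v<c′)

    X[c]≡0 : X c ≡ 0
    X[c]≡0 = lehmer-∷ʳ-∉ _<ᵇ_ A c c∉A

    Y[c]≡0 : Y c ≡ 0
    Y[c]≡0 = lehmer-∷ʳ-∉ _>ᵇ_ D c′ c∉D

    X[c′]≡0 : X c′ ≡ 0
    X[c′]≡0 = lehmer-∷ʳ-∉ _<ᵇ_ A c c′∉A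

    Y[c′]≡0 : Y c′ ≡ 0
    Y[c′]≡0 = lehmer-∷ʳ-∉ _>ᵇ_ D c′ c′∉D

    c′-least : ∀ {v} → X v ≡ 0 → Y v ≡ 0 → toℕ c < toℕ v → toℕ c′ ≤ toℕ v
    c′-least {v} X≡0 Y≡0 c<v with entries-complete v
    ... | here refl         = ⊥-elim (ℕₚ.<-irrefl refl c<v)
    ... | there (here refl) = ℕₚ.≤-refl
    ... | there (there v∈A++D) with ∈-++⁻ A v∈A++D
    ...   | inj₁ v∈A = ⊥-elim (ℕₚ.<-irrefl (sym X≡0) (X-positive v∈A c<v))
    ...   | inj₂ v∈D = ℕₚ.≮⇒≥ (λ v<c′ → ℕₚ.<-irrefl (sym Y≡0) (Y-positive v∈D v<c′))

    column⇐ : ∀ {v} → v ∈ c ∷ A → inColumnᵇ X Y c v ≡ true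
    column⇐ (here refl) = inColumnᵇ-zeros X Y X[c]≡0 Y[c]≡0 ℕₚ.≤-refl
    column⇐ {v} (there v∈A) with X v ℕ.≟ 0
    ... | no  X≢0 = inColumnᵇ-X≢0 X Y c X≢0
    ... | yes X≡0 = inColumnᵇ-zeros X Y X≡0 (lehmer-∷ʳ-∉ _>ᵇ_ D c′ (A∩D≡∅ v∈A))
                      (ℕₚ.≮⇒≥ (λ c<v → ℕₚ.<-irrefl (sym X≡0) (X-positive v∈A c<v)))

    column⇒ : ∀ {v} → inColumnᵇ X Y c v ≡ true → v ∈ c ∷ A
    column⇒ {v} eq with inColumnᵇ-true X Y eq
    ... | inj₁ X≢0 = there (X≢0⇒∈A X≢0)
    ... | inj₂ (X≡0 , Y≡0 , v≤c) with entries-complete v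
    ...   | here refl         = here refl
    ...   | there (here refl) = ⊥-elim (ℕₚ.<-irrefl refl (ℕₚ.<-≤-trans c<c′ v≤c))
    ...   | there (there v∈A++D) with ∈-++⁻ A v∈A++D
    ...     | inj₁ v∈A = there v∈A
    ...     | inj₂ v∈D = ⊥-elim (ℕₚ.<-irrefl (sym Y≡0) (Y-positive v∈D (ℕₚ.≤-<-trans v≤c c<c′)))

    c∷A! : Unique (c ∷ A)
    c∷A! = All.tabulate (λ v∈A c≡v → c∉A (subst (_∈ A) (sym c≡v) v∈A)) ∷ A!

    c′∷D! : Unique (c′ ∷ D)
    c′∷D! = Allₚ.++⁻ʳ A (AllPairs.head (AllPairs.tail entries!)) ∷ D!

    countᵇ-column : countᵇ (inColumnᵇ X Y c) (allFin n) ≡ suc ℓ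
    countᵇ-column = trans (countᵇ-allFin≡length (inColumnᵇ X Y c) c∷A! column⇒ column⇐) (cong suc |A|≡ℓ)

    μ-admissible : ∀ {w} → w ∈ c′ ∷ D → indicator (w <ᵇ c) ≤ Y w
    μ-admissible {w} w∈c′∷D with toℕ w <? toℕ c
    ... | no  w≮c rewrite dec-false (toℕ w <? toℕ c) w≮c = z≤n
    ... | yes w<c rewrite dec-true (toℕ w <? toℕ c) w<c with w∈c′∷D
    ...   | here refl = ⊥-elim (ℕₚ.<-asym w<c c<c′)
    ...   | there w∈D = Y-positive w∈D (ℕₚ.<-trans w<c c<c′)

    ρ-admissible : ∀ {w} → w ∈ c ∷ A → indicator (c′ <ᵇ w) ≤ X w
    ρ-admissible {w} w∈c∷A with toℕ c′ <? toℕ w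
    ... | no  c′≮w rewrite dec-false (toℕ c′ <? toℕ w) c′≮w = z≤n
    ... | yes c′<w rewrite dec-true (toℕ c′ <? toℕ w) c′<w with w∈c∷A
    ...   | here refl = ⊥-elim (ℕₚ.<-asym c′<w c<c′)
    ...   | there w∈A = X-positive w∈A (ℕₚ.<-trans c<c′ c′<w)

    private
      μ-row : Σ (List (Fin n)) λ B → B ↭ c′ ∷ D × (∀ w → lehmer _>ᵇ_ (B ∷ʳ c) w ≡ Y w)
      μ-row = lehmer-replace-last (flip-isStrictTotalᵇ <ᵇ-isStrictTotal) (Uniqueₚ.allFin⁺ n) ∈-allFin
                (AllPairs.map (λ {i} {j} → dec-true (toℕ i <? toℕ j)) allFin-ascending) D c′ c c′∷D! μ-admissible

      ρ-column : Σ (List (Fin n)) λ A′ → A′ ↭ c ∷ A × (∀ w → lehmer _<ᵇ_ (A′ ∷ʳ c′) w ≡ X w)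
      ρ-column = lehmer-replace-last <ᵇ-isStrictTotal
                   (Unique-resp-↭ (↭-sym (↭ₚ.↭-reverse (allFin n))) (Uniqueₚ.allFin⁺ n))
                   (λ i → ↭ₚ.∈-resp-↭ (↭-sym (↭ₚ.↭-reverse (allFin n))) (∈-allFin i))
                   (AllPairs.map (λ {i} {j} → dec-true (toℕ j <? toℕ i)) allFin-descending) A c c′ c∷A! ρ-admissible

      B : List (Fin n)
      B = proj₁ μ-row

      B↭c′∷D : B ↭ c′ ∷ D
      B↭c′∷D = proj₁ (proj₂ μ-row)

      μ-keys↭ : c ∷ A ++ B ↭ c ∷ c′ ∷ A ++ D
      μ-keys↭ = prep c (↭-trans (↭ₚ.++⁺ˡ A B↭c′∷D) (↭ₚ.shift c′ A D))

      A′ : List (Fin n)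
      A′ = proj₁ ρ-column

      A′↭c∷A : A′ ↭ c ∷ A
      A′↭c∷A = proj₁ (proj₂ ρ-column)

      ρ-keys↭ : c′ ∷ A′ ++ D ↭ c ∷ c′ ∷ A ++ D
      ρ-keys↭ = ↭-trans (prep c′ (↭ₚ.++⁺ʳ D A′↭c∷A)) (swap c′ c ↭-refl)

      module μ = HookFilling {r = 2 + a} {h = 1 + ℓ} c A B
        (Unique-resp-↭ (↭-sym μ-keys↭) entries!) (λ i → ↭ₚ.∈-resp-↭ (↭-sym μ-keys↭) (entries-complete i))
        (cong suc |A|≡ℓ) (cong suc (trans (↭ₚ.↭-length B↭c′∷D) (cong suc |D|≡a)))

      module ρ = HookFilling {r = 1 + a} {h = 2 + ℓ} c′ A′ D
        (Unique-resp-↭ (↭-sym ρ-keys↭) entries!) (λ i → ↭ₚ.∈-resp-↭ (↭-sym ρ-keys↭) (entries-complete i))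
        (cong suc (trans (↭ₚ.↭-length A′↭c∷A) (cong suc |A|≡ℓ))) (cong suc |D|≡a)

    μ-filling : Filling n (2 + a) (1 + ℓ)
    μ-filling = μ.filling

    ρ-filling : Filling n (1 + a) (2 + ℓ)
    ρ-filling = ρ.filling

    φ-μ-filling : φ μ-filling ≡ monoP monomial
    φ-μ-filling =
      trans μ.φ-filling (cong (λ y → monoP (tabulate X , y)) (Vecₚ.tabulate-cong (proj₂ (proj₂ μ-row))))

    φ-ρ-filling : φ ρ-filling ≡ monoP monomial
    φ-ρ-filling =
      trans ρ.φ-filling (cong (λ x → monoP (x , tabulate Y)) (Vecₚ.tabulate-cong (proj₂ (proj₂ ρ-column))))


  open ArrangementFacts using (X; Y)

  SameExponents : Arrangement n a ℓ → Arrangement n a ℓ → Set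
  SameExponents g₁ g₂ = (∀ w → X g₁ w ≡ X g₂ w) × (∀ w → Y g₁ w ≡ Y g₂ w)

  SameExponents-sym : ∀ {g₁ g₂} → SameExponents g₁ g₂ → SameExponents g₂ g₁
  SameExponents-sym (X≗ , Y≗) = sym ∘ X≗ , sym ∘ Y≗

  corner-≮ : ∀ g₁ g₂ → SameExponents g₁ g₂ → ¬ (toℕ (Arrangement.c g₁) < toℕ (Arrangement.c g₂))
  corner-≮ g₁ g₂ (X≗ , Y≗) c₁<c₂ = ℕₚ.<-irrefl (trans G₁.countᵇ-column (sym count₂)) more-at-c₂
    where
    module G₁ = ArrangementFacts g₁
    module G₂ = ArrangementFacts g₂
    count₂ : countᵇ (inColumnᵇ G₁.X G₁.Y G₂.c) (allFin n) ≡ suc ℓ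
    count₂ = trans (countᵇ-cong _ _ (allFin n) (λ {v} _ → inColumnᵇ-cong G₂.c X≗ Y≗ v)) G₂.countᵇ-column
    more-at-c₂ : countᵇ (inColumnᵇ G₁.X G₁.Y G₁.c) (allFin n) < countᵇ (inColumnᵇ G₁.X G₁.Y G₂.c) (allFin n)
    more-at-c₂ = countᵇ-mono-< _ _ (allFin n) (λ v → inColumnᵇ-mono G₁.X G₁.Y v (ℕₚ.<⇒≤ c₁<c₂)) (∈-allFin G₂.c)
      (trans (inColumnᵇ-cong G₂.c X≗ Y≗ G₂.c) (G₂.column⇐ (here refl)))
      (inColumnᵇ-above G₁.X G₁.Y (trans (X≗ G₂.c) G₂.X[c]≡0) c₁<c₂)

  module _ (g₁ g₂ : Arrangement n a ℓ) (same : SameExponents g₁ g₂) where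
    private
      module G₁ = ArrangementFacts g₁
      module G₂ = ArrangementFacts g₂

    corner-≡ : G₁.c ≡ G₂.c
    corner-≡ with ℕₚ.<-cmp (toℕ G₁.c) (toℕ G₂.c)
    ... | tri< c₁<c₂ _ _ = ⊥-elim (corner-≮ g₁ g₂ same c₁<c₂)
    ... | tri≈ _ c₁≡c₂ _ = Finₚ.toℕ-injective c₁≡c₂
    ... | tri> _ _ c₂<c₁ = ⊥-elim (corner-≮ g₂ g₁ (SameExponents-sym {g₁} {g₂} same) c₂<c₁)

    corner′-≡ : G₁.c′ ≡ G₂.c′
    corner′-≡ = Finₚ.toℕ-injective (ℕₚ.≤-antisym
      (G₁.c′-least (trans (proj₁ same G₂.c′) G₂.X[c′]≡0) (trans (proj₂ same G₂.c′) G₂.Y[c′]≡0)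
                   (subst (λ z → toℕ z < toℕ G₂.c′) (sym corner-≡) G₂.c<c′))
      (G₂.c′-least (trans (sym (proj₁ same G₁.c′)) G₁.X[c′]≡0) (trans (sym (proj₂ same G₁.c′)) G₁.Y[c′]≡0)
                   (subst (λ z → toℕ z < toℕ G₁.c′) corner-≡ G₁.c<c′)))

    column-⊆ : ∀ {v} → v ∈ G₁.A → v ∈ G₂.A
    column-⊆ {v} v∈A₁ with G₂.column⇒ (trans (sym (inColumnᵇ-cong G₂.c (proj₁ same) (proj₂ same) v))
                                 (subst (λ t → inColumnᵇ G₁.X G₁.Y t v ≡ true) corner-≡ (G₁.column⇐ (there v∈A₁))))
    ... | here refl  = ⊥-elim (G₁.c∉A (subst (_∈ G₁.A) (sym corner-≡) v∈A₁))
    ... | there v∈A₂ = v∈A₂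

  module _ (g₁ g₂ : Arrangement n a ℓ) (same : SameExponents g₁ g₂) where
    private
      module G₁ = ArrangementFacts g₁
      module G₂ = ArrangementFacts g₂
      same′ : SameExponents g₂ g₁
      same′ = SameExponents-sym {g₁} {g₂} same

    column-≡ : G₁.A ≡ G₂.A
    column-≡ = lehmer-injective <ᵇ-isStrictTotal G₁.A G₂.A G₁.A!
      (↭-from-same-members G₁.A! G₂.A! (column-⊆ g₁ g₂ same) (column-⊆ g₂ g₁ same′)) same-lehmer
      where
      same-lehmer : ∀ {w} → w ∈ G₁.A → lehmer _<ᵇ_ G₁.A w ≡ lehmer _<ᵇ_ G₂.A w
      same-lehmer {w} w∈A₁ = ℕₚ.+-cancelʳ-≡ (indicator (G₁.c <ᵇ w)) _ _ (begin
        lehmer _<ᵇ_ G₁.A w + indicator (G₁.c <ᵇ w) ≡⟨ lehmer-∷ʳ _<ᵇ_ G₁.A G₁.c w∈A₁ ⟨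
        G₁.X w                                     ≡⟨ proj₁ same w ⟩
        G₂.X w                                     ≡⟨ lehmer-∷ʳ _<ᵇ_ G₂.A G₂.c (column-⊆ g₁ g₂ same w∈A₁) ⟩
        lehmer _<ᵇ_ G₂.A w + indicator (G₂.c <ᵇ w) ≡⟨ cong (λ z → lehmer _<ᵇ_ G₂.A w + indicator (z <ᵇ w))
                                                           (corner-≡ g₁ g₂ same) ⟨
        lehmer _<ᵇ_ G₂.A w + indicator (G₁.c <ᵇ w) ∎)
        where open ≡-Reasoning

    row-⊆ : ∀ {v} → v ∈ G₁.D → v ∈ G₂.D
    row-⊆ {v} v∈D₁ with G₂.entries-complete v
    ... | here refl         = ⊥-elim (G₁.c∉D (subst (_∈ G₁.D) (sym (corner-≡ g₁ g₂ same)) v∈D₁))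
    ... | there (here refl) = ⊥-elim (G₁.c′∉D (subst (_∈ G₁.D) (sym (corner′-≡ g₁ g₂ same)) v∈D₁))
    ... | there (there v∈A₂++D₂) with ∈-++⁻ G₂.A v∈A₂++D₂
    ...   | inj₁ v∈A₂ = ⊥-elim (G₁.A∩D≡∅ (subst (v ∈_) (sym column-≡) v∈A₂) v∈D₁)
    ...   | inj₂ v∈D₂ = v∈D₂

  row-≡ : ∀ g₁ g₂ → SameExponents g₁ g₂ → Arrangement.D g₁ ≡ Arrangement.D g₂
  row-≡ g₁ g₂ same = lehmer-injective (flip-isStrictTotalᵇ <ᵇ-isStrictTotal) G₁.D G₂.D G₁.D!
    (↭-from-same-members G₁.D! G₂.D! (row-⊆ g₁ g₂ same) (row-⊆ g₂ g₁ (SameExponents-sym {g₁} {g₂} same)))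
    same-lehmer
    where
    module G₁ = ArrangementFacts g₁
    module G₂ = ArrangementFacts g₂
    same-lehmer : ∀ {w} → w ∈ G₁.D → lehmer _>ᵇ_ G₁.D w ≡ lehmer _>ᵇ_ G₂.D w
    same-lehmer {w} w∈D₁ = ℕₚ.+-cancelʳ-≡ (indicator (G₁.c′ >ᵇ w)) _ _ (begin
      lehmer _>ᵇ_ G₁.D w + indicator (G₁.c′ >ᵇ w) ≡⟨ lehmer-∷ʳ _>ᵇ_ G₁.D G₁.c′ w∈D₁ ⟨
      G₁.Y w                                      ≡⟨ proj₂ same w ⟩
      G₂.Y w                                      ≡⟨ lehmer-∷ʳ _>ᵇ_ G₂.D G₂.c′ (row-⊆ g₁ g₂ same w∈D₁) ⟩
      lehmer _>ᵇ_ G₂.D w + indicator (G₂.c′ >ᵇ w) ≡⟨ cong (λ z → lehmer _>ᵇ_ G₂.D w + indicator (z >ᵇ w))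
                                                          (corner′-≡ g₁ g₂ same) ⟨
      lehmer _>ᵇ_ G₂.D w + indicator (G₁.c′ >ᵇ w) ∎)
      where open ≡-Reasoning

toList-tabulate : ∀ {A : Set} {n} (f : Fin n → A) → toList (tabulate f) ≡ Data.List.tabulate f
toList-tabulate {n = zero}  f = refl
toList-tabulate {n = suc n} f = cong (f zero ∷_) (toList-tabulate (f ∘ suc))

tabulate-injective : ∀ {A : Set} {n} {f g : Fin n → A} → tabulate f ≡ tabulate g → ∀ i → f i ≡ g i
tabulate-injective {f = f} {g} eq i =
  trans (sym (Vecₚ.lookup∘tabulate f i)) (trans (cong (λ v → lookup v i) eq) (Vecₚ.lookup∘tabulate g i))

halfFactorial : ℕ → ℕ
halfFactorial zero    = 1
halfFactorial (suc m) = (3 + m) * halfFactorial m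

[2+m]!≡2*halfFactorial : ∀ m → (2 + m) ! ≡ 2 * halfFactorial m
[2+m]!≡2*halfFactorial zero    = refl
[2+m]!≡2*halfFactorial (suc m) = begin
  (3 + m) * (2 + m) !            ≡⟨ cong ((3 + m) *_) ([2+m]!≡2*halfFactorial m) ⟩
  (3 + m) * (2 * halfFactorial m) ≡⟨ m*[n*o]≡n*[m*o] (3 + m) 2 (halfFactorial m) ⟩
  2 * ((3 + m) * halfFactorial m) ∎
  where open ≡-Reasoning

module _ {A : Set} where

  extract : ∀ {k} → Vec A (suc k) → Fin (suc k) → A × Vec A k
  extract (x ∷ xs) zero = x , xs
  extract {suc k} (x ∷ xs) (suc i) = Product.map₂ (x ∷_) (extract xs i)

  extract-↭ : ∀ {k} (V : Vec A (suc k)) i → toList V ↭ proj₁ (extract V i) ∷ toList (proj₂ (extract V i))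
  extract-↭ (x ∷ xs) zero = ↭-refl
  extract-↭ {suc k} (x ∷ xs) (suc i) = ↭-trans (prep x (extract-↭ xs i)) (swap x (proj₁ (extract xs i)) ↭-refl)

  extract-AllPairs : ∀ {R : A → A → Set} {k} (V : Vec A (suc k)) i →
    AllPairs R (toList V) → AllPairs R (toList (proj₂ (extract V i)))
  extract-AllPairs (x ∷ xs) zero (_ ∷ xs↗) = xs↗
  extract-AllPairs {k = suc k} (x ∷ xs) (suc i) (x~xs ∷ xs↗) =
    Allₚ.anti-mono (λ m → ↭ₚ.∈-resp-↭ (↭-sym (extract-↭ xs i)) (there m)) x~xs ∷ extract-AllPairs xs i xs↗

  extract-injective : ∀ {k} (V : Vec A (suc k)) i j → Unique (toList V) →
    proj₁ (extract V i) ≡ proj₁ (extract V j) → i ≡ j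
  extract-injective (x ∷ xs) zero zero _ _ = refl
  extract-injective {suc k} (x ∷ xs) zero (suc j) V! x≡ = ⊥-elim (Uniqueₚ.Unique[x∷xs]⇒x∉xs V!
    (subst (_∈ toList xs) (sym x≡) (↭ₚ.∈-resp-↭ (↭-sym (extract-↭ xs j)) (here refl))))
  extract-injective {suc k} (x ∷ xs) (suc i) zero V! ≡x = ⊥-elim (Uniqueₚ.Unique[x∷xs]⇒x∉xs V!
    (subst (_∈ toList xs) ≡x (↭ₚ.∈-resp-↭ (↭-sym (extract-↭ xs i)) (here refl))))
  extract-injective {suc k} (x ∷ xs) (suc i) (suc j) V! eq = cong suc (extract-injective xs i j (AllPairs.tail V!) eq)

  -- The index chooses the m letters of the word one at a time; the two entries left over, in their
  -- order in V, are returned as the pair.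
  unrank : ∀ m → Vec A (2 + m) → Fin (halfFactorial m) → Vec A m × A × A
  unrank zero    (u ∷ v ∷ []) _   = [] , u , v
  unrank (suc m) V            idx =
    let i , j = remQuot {3 + m} (halfFactorial m) idx
        x , V′ = extract V i
    in Product.map₁ (x ∷_) (unrank m V′ j)

  unrank-↭ : ∀ m V idx → let Q , c , c′ = unrank m V idx in toList V ↭ c ∷ c′ ∷ toList Q
  unrank-↭ zero    (u ∷ v ∷ []) _   = ↭-refl
  unrank-↭ (suc m) V            idx =
    let i , j = remQuot {3 + m} (halfFactorial m) idx
        x , V′ = extract V i
        Q , c , c′ = unrank m V′ j
    in ↭-trans (extract-↭ V i) (↭-trans (prep x (unrank-↭ m V′ j))
         (↭-trans (swap x c ↭-refl) (prep c (swap x c′ ↭-refl))))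

  unrank-ordered : ∀ {R : A → A → Set} m V idx → AllPairs R (toList V) →
    let _ , c , c′ = unrank m V idx in R c c′
  unrank-ordered zero    (u ∷ v ∷ []) _   ((u~v ∷ []) ∷ _) = u~v
  unrank-ordered (suc m) V            idx V↗ =
    let i , j = remQuot {3 + m} (halfFactorial m) idx
    in unrank-ordered m (proj₂ (extract V i)) j (extract-AllPairs V i V↗)

  unrank-injective : ∀ m V i j → Unique (toList V) → unrank m V i ≡ unrank m V j → i ≡ j
  unrank-injective zero    (u ∷ v ∷ []) zero zero _ _ = refl
  unrank-injective (suc m) V i j V! eq = begin
    i                                      ≡⟨ Finₚ.combine-remQuot {3 + m} (halfFactorial m) i ⟨
    combine (proj₁ i′) (proj₂ i′)          ≡⟨ cong₂ combine same-extracted same-rest ⟩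
    combine (proj₁ j′) (proj₂ j′)          ≡⟨ Finₚ.combine-remQuot {3 + m} (halfFactorial m) j ⟩
    j                                      ∎
    where
    open ≡-Reasoning
    i′ j′ : Fin (3 + m) × Fin (halfFactorial m)
    i′ = remQuot {3 + m} (halfFactorial m) i
    j′ = remQuot {3 + m} (halfFactorial m) j
    same-extracted : proj₁ i′ ≡ proj₁ j′
    same-extracted = extract-injective V (proj₁ i′) (proj₁ j′) V! (cong (Vec.head ∘ proj₁) eq)
    same-rest : proj₂ i′ ≡ proj₂ j′
    same-rest = unrank-injective m (proj₂ (extract V (proj₁ j′))) (proj₂ i′) (proj₂ j′)
      (AllPairs.tail (Unique-resp-↭ (extract-↭ V (proj₁ j′)) V!))
      (subst (λ k → unrank m (proj₂ (extract V k)) (proj₂ i′) ≡ unrank m (proj₂ (extract V (proj₁ j′))) (proj₂ j′))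
        same-extracted (cong (Product.map₁ Vec.tail) eq))

φ-span : ∀ {n r h} (S : Filling n r h) {M : Mono n} → φ S ≡ monoP M → InH n r h (monoP M)
φ-span S {M} φS≡M = ((1ℚ , S) ∷ []) , λ m →
  subst (λ p → coeff (monoP M) m ≡ coeff (scale 1ℚ p ++ []) m) (sym φS≡M)
        (cong (λ q → coeff ((q , M) ∷ []) m) (sym (ℚₚ.*-identityˡ 1ℚ)))

module _ {n k : ℕ} (M : Fin k → Mono n) (M-injective : ∀ {i j} → M i ≡ M j → i ≡ j) (λ′ : Fin k → ℚ) where

  private
    combination : List (Fin k) → Poly n
    combination L = linComb (map (λ i → λ′ i , monoP (M i)) L)

  coeff-combination-∉ : ∀ L {i} → i ∉ L → coeff (combination L) (M i) ≡ 0ℚ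
  coeff-combination-∉ []      _   = refl
  coeff-combination-∉ (j ∷ L) {i} i∉ with mono-≟ (M j) (M i)
  ... | yes Mj≡Mi = ⊥-elim (i∉ (here (sym (M-injective Mj≡Mi))))
  ... | no  _     = coeff-combination-∉ L (i∉ ∘ there)

  coeff-combination-∈ : ∀ L {i} → Unique L → i ∈ L → coeff (combination L) (M i) ≡ λ′ i
  coeff-combination-∈ (j ∷ L) L! (here refl) with mono-≟ (M j) (M j)
  ... | yes _ rewrite coeff-combination-∉ L (Uniqueₚ.Unique[x∷xs]⇒x∉xs L!) =
    trans (ℚₚ.+-identityʳ _) (ℚₚ.*-identityʳ _)
  ... | no Mj≢Mj = ⊥-elim (Mj≢Mj refl)
  coeff-combination-∈ (j ∷ L) {i} L! (there i∈L) with mono-≟ (M j) (M i)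
  ... | yes Mj≡Mi = ⊥-elim (Uniqueₚ.Unique[x∷xs]⇒x∉xs L! (subst (_∈ L) (sym (M-injective Mj≡Mi)) i∈L))
  ... | no  _     = coeff-combination-∈ L (AllPairs.tail L!) i∈L

monomials-linearlyIndependent : ∀ {n k} (M : Fin k → Mono n) → (∀ {i j} → M i ≡ M j → i ≡ j) → LinIndep (monoP ∘ M)
monomials-linearlyIndependent {k = k} M M-injective λ′ combination≈0 i =
  trans (sym (coeff-combination-∈ M M-injective λ′ (allFin k) (Uniqueₚ.allFin⁺ k) (∈-allFin i))) (combination≈0 (M i))

module _ (a ℓ : ℕ) where

  private
    n : ℕ
    n = 2 + (ℓ + a)

    allFinᵛ! : Unique (toList (Vec.allFin n))
    allFinᵛ! = subst Unique (sym (toList-tabulate id)) (Uniqueₚ.allFin⁺ n)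

  arrangement : Fin (halfFactorial (ℓ + a)) → Arrangement n a ℓ
  arrangement idx = record
    { c                = c
    ; c′               = c′
    ; A                = take ℓ (toList Q)
    ; D                = drop ℓ (toList Q)
    ; c<c′             = unrank-ordered (ℓ + a) (Vec.allFin n) idx
                           (subst (AllPairs _) (sym (toList-tabulate id)) allFin-ascending)
    ; entries!         = Unique-resp-↭ entries↭ allFinᵛ!
    ; entries-complete = λ i → ↭ₚ.∈-resp-↭ entries↭ (subst (i ∈_) (sym (toList-tabulate id)) (∈-allFin i))
    ; |A|≡ℓ            = trans (Listₚ.length-take ℓ (toList Q))
                           (trans (cong (ℓ ℕ.⊓_) |Q|) (ℕₚ.m≤n⇒m⊓n≡m (ℕₚ.m≤m+n ℓ a)))
    ; |D|≡a            = trans (Listₚ.length-drop ℓ (toList Q)) (trans (cong (_∸ ℓ) |Q|) (ℕₚ.m+n∸m≡n ℓ a))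
    }
    where
    Q : Vec (Fin n) (ℓ + a)
    Q = proj₁ (unrank (ℓ + a) (Vec.allFin n) idx)
    c c′ : Fin n
    c = proj₁ (proj₂ (unrank (ℓ + a) (Vec.allFin n) idx))
    c′ = proj₂ (proj₂ (unrank (ℓ + a) (Vec.allFin n) idx))
    |Q| : length (toList Q) ≡ ℓ + a
    |Q| = Vecₚ.length-toList Q
    entries↭ : toList (Vec.allFin n) ↭ c ∷ c′ ∷ take ℓ (toList Q) ++ drop ℓ (toList Q)
    entries↭ = subst (λ L → toList (Vec.allFin n) ↭ c ∷ c′ ∷ L) (sym (Listₚ.take++drop≡id ℓ (toList Q)))
                 (unrank-↭ (ℓ + a) (Vec.allFin n) idx)

  open ArrangementFacts using (monomial; μ-filling; ρ-filling; φ-μ-filling; φ-ρ-filling)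

  arrangement-injective : ∀ {i j} → monomial (arrangement i) ≡ monomial (arrangement j) → i ≡ j
  arrangement-injective {i} {j} eq = unrank-injective (ℓ + a) (Vec.allFin n) i j allFinᵛ!
    (cong₂ _,_ same-Q (cong₂ _,_ (corner-≡ gᵢ gⱼ same) (corner′-≡ gᵢ gⱼ same)))
    where
    gᵢ gⱼ : Arrangement n a ℓ
    gᵢ = arrangement i
    gⱼ = arrangement j
    same : SameExponents gᵢ gⱼ
    same = tabulate-injective (cong proj₁ eq) , tabulate-injective (cong proj₂ eq)
    Qᵢ Qⱼ : Vec (Fin n) (ℓ + a)
    Qᵢ = proj₁ (unrank (ℓ + a) (Vec.allFin n) i)
    Qⱼ = proj₁ (unrank (ℓ + a) (Vec.allFin n) j)
    same-Q : Qᵢ ≡ Qⱼ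
    same-Q = trans (sym (Vecₚ.cast-is-id refl Qᵢ)) (Vecₚ.toList-injective refl Qᵢ Qⱼ (begin
      toList Qᵢ                              ≡⟨ Listₚ.take++drop≡id ℓ (toList Qᵢ) ⟨
      take ℓ (toList Qᵢ) ++ drop ℓ (toList Qᵢ) ≡⟨ cong₂ _++_ (column-≡ gᵢ gⱼ same) (row-≡ gᵢ gⱼ same) ⟩
      take ℓ (toList Qⱼ) ++ drop ℓ (toList Qⱼ) ≡⟨ Listₚ.take++drop≡id ℓ (toList Qⱼ) ⟩
      toList Qⱼ                              ∎))
      where open ≡-Reasoning

  common-monomials : Σ ℕ λ k → n ! ≤ 2 * k ×
    Σ (Fin k → Poly n) λ f → (∀ i → InH n (2 + a) (1 + ℓ) (f i) × InH n (1 + a) (2 + ℓ) (f i)) × LinIndep f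
  common-monomials =
    halfFactorial (ℓ + a) , ℕₚ.≤-reflexive ([2+m]!≡2*halfFactorial (ℓ + a)) ,
    monoP ∘ monomial ∘ arrangement ,
    (λ i → φ-span (μ-filling (arrangement i)) (φ-μ-filling (arrangement i)) ,
           φ-span (ρ-filling (arrangement i)) (φ-ρ-filling (arrangement i))) ,
    monomials-linearlyIndependent (monomial ∘ arrangement) arrangement-injective

mainTheorem4 : (a ℓ : ℕ) → 2 ≤ a → 1 ≤ ℓ →
    Σ ℕ λ k → ((a + ℓ ∸ 1) ! ≤ 2 * k) ×
      Σ (Fin k → Poly (a + ℓ ∸ 1)) λ f →
        (∀ i → InH (a + ℓ ∸ 1) a ℓ (f i) × InH (a + ℓ ∸ 1) (a ∸ 1) (ℓ + 1) (f i))
        × LinIndep f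
mainTheorem4 (suc (suc a)) (suc ℓ) _ _ = subst₂ Goal (sym n≡) (sym h≡) (common-monomials a ℓ)
  where
  Goal : ℕ → ℕ → Set
  Goal n h = Σ ℕ λ k → (n ! ≤ 2 * k) ×
    Σ (Fin k → Poly n) λ f → (∀ i → InH n (2 + a) (1 + ℓ) (f i) × InH n (1 + a) h (f i)) × LinIndep f
  n≡ : 2 + a + suc ℓ ∸ 1 ≡ 2 + (ℓ + a)
  n≡ = cong suc (trans (ℕₚ.+-suc a ℓ) (cong suc (ℕₚ.+-comm a ℓ)))
  h≡ : suc ℓ + 1 ≡ 2 + ℓ
  h≡ = cong suc (ℕₚ.+-comm ℓ 1)
mainTheorem4 0             _       ()            _
mainTheorem4 1             _       (s≤s ())      _
mainTheorem4 (suc (suc _)) 0       _             ()
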